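{- For all $n\in\mathbb{N}_0$ and $d\in\mathbb{N}$, \[ \sum_{n_1>n_2>\cdots>n_d>n}\frac{a_{n_1}}{(2n_1-1)(2n_2-1)\cdots(2n_d-1)}=a_n . \]
   Context: For $n\in\mathbb{N}_0$, $a_n=\frac{1}{4^n}\binom{2n}{n}$ (so $a_0=1$). -}

module Defs where

open import Data.Nat as ℕ using (ℕ; zero; suc; _∸_; _^_)
open import Data.Nat.Properties using (m^n≢0)
open import Data.Nat.Combinatorics using (_C_)
open import Data.Integer using (+_)
open import Data.Rational using (ℚ; 0ℚ; 1ℚ; _/_; _+_; _*_)

a : ℕ → ℚ
a n = (+ ((2 ℕ.* n) C n)) / (4 ^ n)
  where instance _ = m^n≢0 4 n

-- Σ_{lo ≤ m < hi} f m   (empty if hi ≤ lo)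
sumFrom : ℕ → ℕ → (ℕ → ℚ) → ℚ
sumFrom lo zero f = 0ℚ
sumFrom lo (suc h) f = sumFrom lo h f + (if lo ℕ.≤ᵇ h then f h else 0ℚ)
  where open import Data.Bool using (if_then_else_)

-- recip m = 1/(2m-1) for m ≥ 1  (2(k+1)-1 = 2k+1); value at m = 0 is never used
recip : ℕ → ℚ
recip zero = 0ℚ
recip (suc k) = (+ 1) / suc (2 ℕ.* k)

-- tailSum n k u = Σ_{u > m_1 > m_2 > ... > m_k > n} 1/((2m_1-1)...(2m_k-1))
tailSum : ℕ → ℕ → ℕ → ℚ
tailSum n zero u = 1ℚ
tailSum n (suc k) u = sumFrom (suc n) u (λ m → recip m * tailSum n k m)

-- partialSum n d N = Σ_{N ≥ n_1 > n_2 > ... > n_d > n} a_{n_1}/((2n_1-1)...(2n_d-1))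
-- (only meaningful for d ≥ 1; d = 0 is set to 0 and never used)
partialSum : ℕ → ℕ → ℕ → ℚ
partialSum n zero N = 0ℚ
partialSum n (suc k) N = sumFrom (suc n) (suc N) (λ n₁ → a n₁ * recip n₁ * tailSum n k n₁)

-- With h_N = 1/(2N+2) one has a_{N+1} = (1 - h_N) a_N and a_{N+1}/(2N+1) = h_N a_N.
-- Put B_j(N) = a_N Σ_{N ≥ m_1 > ⋯ > m_j > n} ∏ 1/(2m_i - 1). For N ≥ n the partial sum of
-- the d-fold series over n_1 ≤ N equals a_n - Σ_{j<d} B_j(N): both sides agree at N = n, and
-- the increments cancel by the two identities above. So it suffices that every B_j tends to 0.
-- B_0 = a does, as a_N² (2N+1) ≤ 1, and B_{j+1}(N+1) = (1 - h_N) B_{j+1}(N) + h_N B_j(N) is a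
-- recurrence damped by the same factors that drive a_N to 0.
module Submission where

module CentralBinomial where
  open import Data.Nat using (ℕ; zero; suc; _^_; z≤n; s≤s; _*_; _+_; _≤_; _<_)
  open import Data.Nat.Properties
  open import Data.Nat.Combinatorics using (_C_; nCk+nC[k+1]≡[n+1]C[k+1]; k>n⇒nCk≡0; nC1≡n; nCk≡nC[n∸k])
  open import Data.Nat.Tactic.RingSolver using (solve-∀)
  open import Data.Empty using (⊥-elim)
  open import Relation.Nullary using (yes; no)
  open import Relation.Binary.PropositionalEquality
  open import Algebra.Properties.CommutativeSemigroup *-commutativeSemigroup using (x∙yz≈y∙xz)

  [k+1]*[n+1]C[k+1]≡[n+1]*nCk : ∀ n k → suc k * (suc n C suc k) ≡ suc n * (n C k)
  [k+1]*[n+1]C[k+1]≡[n+1]*nCk n zero = trans (+-identityʳ _) (trans (nC1≡n (suc n)) (sym (*-identityʳ (suc n))))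
  [k+1]*[n+1]C[k+1]≡[n+1]*nCk zero (suc k)
    rewrite k>n⇒nCk≡0 {1} {suc (suc k)} (s≤s (s≤s z≤n)) | k>n⇒nCk≡0 {0} {suc k} (s≤s z≤n) = *-zeroʳ (suc (suc k))
  [k+1]*[n+1]C[k+1]≡[n+1]*nCk (suc n) (suc k) = begin
    suc j * (suc m C suc j)                   ≡⟨ cong (suc j *_) (nCk+nC[k+1]≡[n+1]C[k+1] m j) ⟨
    suc j * (m C j + m C suc j)               ≡⟨ *-distribˡ-+ (suc j) (m C j) _ ⟩
    suc j * (m C j) + suc j * (m C suc j)     ≡⟨ cong₂ _+_ (cong (m C j +_) IH-k) IH-j ⟩
    (m C j + m * (n C k)) + m * (n C j)       ≡⟨ +-assoc (m C j) _ _ ⟩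
    m C j + (m * (n C k) + m * (n C j))       ≡⟨ cong (m C j +_) (*-distribˡ-+ m (n C k) (n C j)) ⟨
    m C j + m * (n C k + n C j)               ≡⟨ cong (λ x → m C j + m * x) (nCk+nC[k+1]≡[n+1]C[k+1] n k) ⟩
    suc m * (m C j)                           ∎
    where
    open ≡-Reasoning
    m = suc n
    j = suc k
    IH-k = [k+1]*[n+1]C[k+1]≡[n+1]*nCk n k
    IH-j = [k+1]*[n+1]C[k+1]≡[n+1]*nCk n j

  central : ℕ → ℕ
  central n = (2 * n) C n

  central-suc : ∀ n → suc n * central (suc n) ≡ 2 * suc (2 * n) * central n
  central-suc n = *-cancelˡ-≡ _ _ (suc n) (begin
    suc n * (suc n * ((2 * suc n) C suc n))        ≡⟨ cong (λ m → suc n * (suc n * (m C suc n))) 2[n+1]≡2n+2 ⟩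
    suc n * (suc n * (suc (suc (2 * n)) C suc n))  ≡⟨ cong (suc n *_) ([k+1]*[n+1]C[k+1]≡[n+1]*nCk (suc (2 * n)) n) ⟩
    suc n * (suc (suc (2 * n)) * (suc (2 * n) C n)) ≡⟨ cong (λ m → suc n * (suc (suc (2 * n)) * m)) symmetric ⟩
    suc n * (suc (suc (2 * n)) * (suc (2 * n) C suc n)) ≡⟨ x∙yz≈y∙xz (suc n) (suc (suc (2 * n))) (suc (2 * n) C suc n) ⟩
    suc (suc (2 * n)) * (suc n * (suc (2 * n) C suc n)) ≡⟨ cong (suc (suc (2 * n)) *_) ([k+1]*[n+1]C[k+1]≡[n+1]*nCk (2 * n) n) ⟩
    suc (suc (2 * n)) * (suc (2 * n) * central n)      ≡⟨ regroup n (central n) ⟩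
    suc n * (2 * suc (2 * n) * central n)              ∎)
    where
    open ≡-Reasoning
    2[n+1]≡2n+2 : 2 * suc n ≡ suc (suc (2 * n))
    2[n+1]≡2n+2 = *-distribˡ-+ 2 1 n
    symmetric : suc (2 * n) C n ≡ suc (2 * n) C suc n
    symmetric = trans (nCk≡nC[n∸k] (≤-trans (n≤1+n n) (s≤s (m≤n*m n 2))))
                      (cong (suc (2 * n) C_) (trans (+-∸-assoc 1 (m≤n*m n 2)) (cong suc (trans (m+n∸m≡n n (1 * n)) (*-identityˡ n)))))
    regroup : ∀ n c → suc (suc (2 * n)) * (suc (2 * n) * c) ≡ suc n * (2 * suc (2 * n) * c)
    regroup = solve-∀

  k≤n⇒0<nCk : ∀ {n k} → k ≤ n → 0 < n C k
  k≤n⇒0<nCk {n} {zero} _ = s≤s z≤n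
  k≤n⇒0<nCk {suc n} {suc k} (s≤s k≤n) =
    <-≤-trans (k≤n⇒0<nCk k≤n) (subst (n C k ≤_) (nCk+nC[k+1]≡[n+1]C[k+1] n k) (m≤m+n _ _))

  central-pos : ∀ n → 0 < central n
  central-pos n = k≤n⇒0<nCk (m≤n*m n 2)

  central²*[2n+1]≤16^n : ∀ n → central n * central n * suc (2 * n) ≤ 4 ^ n * 4 ^ n
  central²*[2n+1]≤16^n zero = ≤-refl
  central²*[2n+1]≤16^n (suc n) = *-cancelˡ-≤ (suc n * suc n) (begin
    suc n * suc n * (c′ * c′ * suc (2 * suc n))                   ≡⟨ square-out n c′ ⟩
    (suc n * c′) * (suc n * c′) * suc (2 * suc n)                 ≡⟨ cong (λ x → x * x * suc (2 * suc n)) (central-suc n) ⟩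
    (2 * suc (2 * n) * c) * (2 * suc (2 * n) * c) * suc (2 * suc n) ≡⟨ square-in n c ⟩
    4 * suc (2 * n) * (suc (2 * n) * suc (2 * suc n)) * (c * c)   ≤⟨ *-monoˡ-≤ (c * c) (*-monoʳ-≤ (4 * suc (2 * n)) odd-product) ⟩
    4 * suc (2 * n) * (4 * (suc n * suc n)) * (c * c)             ≡⟨ regroup n c ⟩
    16 * (suc n * suc n) * (c * c * suc (2 * n))                  ≤⟨ *-monoʳ-≤ (16 * (suc n * suc n)) (central²*[2n+1]≤16^n n) ⟩
    16 * (suc n * suc n) * (4 ^ n * 4 ^ n)                        ≡⟨ powers n (4 ^ n) ⟩
    suc n * suc n * (4 ^ suc n * 4 ^ suc n)                       ∎)
    where
    open ≤-Reasoning
    c = central n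
    c′ = central (suc n)
    odd-product : suc (2 * n) * suc (2 * suc n) ≤ 4 * (suc n * suc n)
    odd-product = subst (suc (2 * n) * suc (2 * suc n) ≤_) (sym (square-even n)) (m≤m+n _ 1)
      where
      square-even : ∀ n → 4 * (suc n * suc n) ≡ suc (2 * n) * suc (2 * suc n) + 1
      square-even = solve-∀
    square-out : ∀ n c → suc n * suc n * (c * c * suc (2 * suc n)) ≡ (suc n * c) * (suc n * c) * suc (2 * suc n)
    square-out = solve-∀
    square-in : ∀ n c → (2 * suc (2 * n) * c) * (2 * suc (2 * n) * c) * suc (2 * suc n)
                      ≡ 4 * suc (2 * n) * (suc (2 * n) * suc (2 * suc n)) * (c * c)
    square-in = solve-∀
    regroup : ∀ n c → 4 * suc (2 * n) * (4 * (suc n * suc n)) * (c * c) ≡ 16 * (suc n * suc n) * (c * c * suc (2 * n))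
    regroup = solve-∀
    powers : ∀ n p → 16 * (suc n * suc n) * (p * p) ≡ suc n * suc n * (4 * p * (4 * p))
    powers = solve-∀

  m*m≤n*n⇒m≤n : ∀ {m n} → m * m ≤ n * n → m ≤ n
  m*m≤n*n⇒m≤n {m} {n} m²≤n² with m ≤? n
  ... | yes m≤n = m≤n
  ... | no m≰n = ⊥-elim (<⇒≱ (*-mono-< (≰⇒> m≰n) (≰⇒> m≰n)) m²≤n²)

  K*K≤n⇒central*K≤4^n : ∀ {K n} → K * K ≤ n → central n * K ≤ 4 ^ n
  K*K≤n⇒central*K≤4^n {K} {n} K²≤n = m*m≤n*n⇒m≤n (begin
    central n * K * (central n * K)        ≡⟨ interchange (central n) K ⟩
    central n * central n * (K * K)        ≤⟨ *-monoʳ-≤ (central n * central n) (≤-trans K²≤n (≤-trans (m≤n*m n 2) (n≤1+n _))) ⟩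
    central n * central n * suc (2 * n)    ≤⟨ central²*[2n+1]≤16^n n ⟩
    4 ^ n * 4 ^ n                          ∎)
    where
    open ≤-Reasoning
    interchange : ∀ c K → c * K * (c * K) ≡ c * c * (K * K)
    interchange = solve-∀

open CentralBinomial using (central; central-suc; central-pos; K*K≤n⇒central*K≤4^n)

open import Data.Nat as ℕ using (ℕ; zero; suc; _^_; z≤n; s≤s; _⊔_)
import Data.Nat.Properties as ℕ
open import Data.Nat.Tactic.RingSolver using (solve-∀)
open import Data.Integer as ℤ using (+_; -[1+_])
import Data.Integer.Properties as ℤ
open import Data.Rational using (ℚ; mkℚ; _/_; _+_; _*_; _-_; -_; 0ℚ; 1ℚ; ∣_∣; _≤_; _<_; toℚᵘ; 1/_; *<*; positive; nonNegative; nonPositive)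
open import Data.Rational.Properties
open import Data.Rational.Unnormalised as ℚᵘ using (mkℚᵘ) renaming (_≃_ to _≃ᵘ_)
import Data.Rational.Unnormalised.Properties as ℚᵘ
open import Data.Rational.Solver using (module +-*-Solver)
open +-*-Solver using (solve; _:+_; _:-_; _:*_; :-_; _:=_; con)
open import Data.Bool using (true; false; T; if_then_else_)
open import Data.Product using (Σ; _,_)
open import Data.Empty using (⊥-elim)
open import Relation.Nullary using (yes; no)
open import Relation.Binary.PropositionalEquality

open import Defs

toℚᵘ-+/ : ∀ m d .{{_ : ℕ.NonZero d}} → toℚᵘ (+ m / d) ≃ᵘ mkℚᵘ (+ m) (ℕ.pred d)
toℚᵘ-+/ m (suc d) = toℚᵘ-fromℚᵘ (mkℚᵘ (+ m) d)

+m/d≡+n/e : ∀ m n d e .{{_ : ℕ.NonZero d}} .{{_ : ℕ.NonZero e}} → m ℕ.* e ≡ n ℕ.* d → + m / d ≡ + n / e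
+m/d≡+n/e m n d@(suc _) e@(suc _) me≡nd = toℚᵘ-injective
  (ℚᵘ.≃-trans (toℚᵘ-+/ m d) (ℚᵘ.≃-trans (ℚᵘ.*≡* (trans (sym (ℤ.pos-* m e)) (trans (cong +_ me≡nd) (ℤ.pos-* n d))))
              (ℚᵘ.≃-sym (toℚᵘ-+/ n e))))

+m/d≤+n/e : ∀ m n d e .{{_ : ℕ.NonZero d}} .{{_ : ℕ.NonZero e}} → m ℕ.* e ℕ.≤ n ℕ.* d → + m / d ≤ + n / e
+m/d≤+n/e m n d@(suc _) e@(suc _) me≤nd = toℚᵘ-cancel-≤
  (ℚᵘ.≤-respˡ-≃ (ℚᵘ.≃-sym (toℚᵘ-+/ m d)) (ℚᵘ.≤-respʳ-≃ (ℚᵘ.≃-sym (toℚᵘ-+/ n e))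
    (ℚᵘ.*≤* (subst₂ ℤ._≤_ (ℤ.pos-* m e) (ℤ.pos-* n d) (ℤ.+≤+ me≤nd)))))

+m/d*+n/e : ∀ m n d e .{{_ : ℕ.NonZero d}} .{{_ : ℕ.NonZero e}} →
            (+ m / d) * (+ n / e) ≡ (+ (m ℕ.* n) / (d ℕ.* e)) {{ℕ.m*n≢0 d e}}
+m/d*+n/e m n d@(suc _) e@(suc _) = toℚᵘ-injective
  (ℚᵘ.≃-trans (toℚᵘ-homo-* (+ m / d) (+ n / e))
  (ℚᵘ.≃-trans (ℚᵘ.*-cong (toℚᵘ-+/ m d) (toℚᵘ-+/ n e))
  (ℚᵘ.≃-trans (ℚᵘ.*≡* (cong (ℤ._* + (d ℕ.* e)) (sym (ℤ.pos-* m n))))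
  (ℚᵘ.≃-sym (toℚᵘ-+/ (m ℕ.* n) (d ℕ.* e))))))

+m/d++n/e : ∀ m n d e .{{_ : ℕ.NonZero d}} .{{_ : ℕ.NonZero e}} →
            (+ m / d) + (+ n / e) ≡ (+ (m ℕ.* e ℕ.+ n ℕ.* d) / (d ℕ.* e)) {{ℕ.m*n≢0 d e}}
+m/d++n/e m n d@(suc _) e@(suc _) = toℚᵘ-injective
  (ℚᵘ.≃-trans (toℚᵘ-homo-+ (+ m / d) (+ n / e))
  (ℚᵘ.≃-trans (ℚᵘ.+-cong (toℚᵘ-+/ m d) (toℚᵘ-+/ n e))
  (ℚᵘ.≃-trans (ℚᵘ.*≡* (cong (ℤ._* + (d ℕ.* e)) numerator))
  (ℚᵘ.≃-sym (toℚᵘ-+/ (m ℕ.* e ℕ.+ n ℕ.* d) (d ℕ.* e))))))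
  where
  numerator : + m ℤ.* + e ℤ.+ + n ℤ.* + d ≡ + (m ℕ.* e ℕ.+ n ℕ.* d)
  numerator = sym (trans (ℤ.pos-+ (m ℕ.* e) (n ℕ.* d)) (cong₂ ℤ._+_ (ℤ.pos-* m e) (ℤ.pos-* n d)))

0≤+m/d : ∀ m d .{{_ : ℕ.NonZero d}} → 0ℚ ≤ + m / d
0≤+m/d m d = nonNegative⁻¹ (+ m / d) {{normalize-nonNeg m d}}

0≤p*q : ∀ {p q} → 0ℚ ≤ p → 0ℚ ≤ q → 0ℚ ≤ p * q
0≤p*q {p} {q} 0≤p 0≤q = nonNegative⁻¹ (p * q) {{nonNeg*nonNeg⇒nonNeg p {{nonNegative 0≤p}} q {{nonNegative 0≤q}}}}

0<p*q : ∀ {p q} → 0ℚ < p → 0ℚ < q → 0ℚ < p * q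
0<p*q {p} {q} 0<p 0<q = positive⁻¹ (p * q) {{pos*pos⇒pos p {{positive 0<p}} q {{positive 0<q}}}}

r*-mono-≤ : ∀ {r p q} → 0ℚ ≤ r → p ≤ q → r * p ≤ r * q
r*-mono-≤ {r} 0≤r = *-monoˡ-≤-nonNeg r {{nonNegative 0≤r}}

½ : ℚ
½ = + 1 / 2

ε*½+ε*½≡ε : ∀ ε → ε * ½ + ε * ½ ≡ ε
ε*½+ε*½≡ε ε = trans (sym (*-distribˡ-+ ε ½ ½)) (*-identityʳ ε)

0<ε*½ : ∀ {ε} → 0ℚ < ε → 0ℚ < ε * ½
0<ε*½ 0<ε = 0<p*q 0<ε (positive⁻¹ ½)

archimedean : ∀ ε → 0ℚ < ε → Σ ℕ λ K → + 1 / suc K < ε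
archimedean (mkℚ (+ suc p) d _) _ = suc d , toℚᵘ-cancel-<
  (ℚᵘ.<-respˡ-≃ (ℚᵘ.≃-sym (toℚᵘ-+/ 1 (suc (suc d)))) (ℚᵘ.*<* (ℤ.+<+ 1+d<[1+p][2+d])))
  where
  1+d<[1+p][2+d] : 1 ℕ.* suc d ℕ.< suc p ℕ.* suc (suc d)
  1+d<[1+p][2+d] = ℕ.<-≤-trans (ℕ.*-monoʳ-< 1 (ℕ.n<1+n (suc d))) (ℕ.*-monoˡ-≤ (suc (suc d)) (s≤s (z≤n {p})))
archimedean (mkℚ (+ zero) _ _) (*<* (ℤ.+<+ ()))
archimedean (mkℚ -[1+ _ ] _ _) (*<* ())

-- limsup f ≤ 0; for the nonnegative sequences below this is convergence to 0.
Negligible : (ℕ → ℚ) → Set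
Negligible f = ∀ ε → 0ℚ < ε → Σ ℕ λ N₀ → ∀ N → N₀ ℕ.≤ N → f N < ε

Negligible-*-pos : ∀ {w} → Negligible w → ∀ c → 0ℚ < c → Negligible (λ N → w N * c)
Negligible-*-pos {w} w≈0 c 0<c ε 0<ε =
  let N₀ , w<ε/c = w≈0 (ε * 1/ c) 0<ε/c
  in N₀ , λ N N₀≤N → subst (w N * c <_) ε/c*c≡ε (*-monoˡ-<-pos c (w<ε/c N N₀≤N))
  where
  instance
    _ = positive 0<c
    _ = pos⇒nonZero c
  0<ε/c : 0ℚ < ε * 1/ c
  0<ε/c = 0<p*q 0<ε (positive⁻¹ (1/ c) {{1/pos⇒pos c}})
  ε/c*c≡ε : ε * 1/ c * c ≡ ε
  ε/c*c≡ε = trans (*-assoc ε (1/ c) c) (trans (cong (ε *_) (*-inverseˡ c)) (*-identityʳ ε))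

Negligible-*ʳ : ∀ {w} → (∀ N → 0ℚ ≤ w N) → Negligible w → ∀ c → Negligible (λ N → w N * c)
Negligible-*ʳ {w} 0≤w w≈0 c with c ≤? 0ℚ
... | no c≰0 = Negligible-*-pos w≈0 c (≰⇒> c≰0)
... | yes c≤0 = λ ε 0<ε → 0 , λ N _ → ≤-<-trans (w[N]*c≤0 N) 0<ε
  where
  w[N]*c≤0 : ∀ N → w N * c ≤ 0ℚ
  w[N]*c≤0 N = nonPositive⁻¹ (w N * c) {{nonNeg*nonPos⇒nonPos (w N) {{nonNegative (0≤w N)}} c {{nonPositive c≤0}}}}

Negligible-+ : ∀ {f g} → Negligible f → Negligible g → Negligible (λ N → f N + g N)
Negligible-+ {f} {g} f≈0 g≈0 ε 0<ε =
  let M , f<ε/2 = f≈0 (ε * ½) (0<ε*½ 0<ε)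
      M′ , g<ε/2 = g≈0 (ε * ½) (0<ε*½ 0<ε)
  in M ⊔ M′ , λ N M⊔M′≤N → subst (f N + g N <_) (ε*½+ε*½≡ε ε)
       (+-mono-< (f<ε/2 N (ℕ.≤-trans (ℕ.m≤m⊔n M M′) M⊔M′≤N)) (g<ε/2 N (ℕ.≤-trans (ℕ.m≤n⊔m M M′) M⊔M′≤N)))

module DampedRecurrence
  (h w : ℕ → ℚ) (0≤h : ∀ n → 0ℚ ≤ h n) (h≤1 : ∀ n → h n ≤ 1ℚ)
  (0<w : ∀ n → 0ℚ < w n) (w-suc : ∀ n → w (suc n) ≡ (1ℚ - h n) * w n) (w≈0 : Negligible w)
  where

  0≤w : ∀ n → 0ℚ ≤ w n
  0≤w n = <⇒≤ (0<w n)

  0≤1-h : ∀ n → 0ℚ ≤ 1ℚ - h n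
  0≤1-h n = subst (_≤ 1ℚ - h n) (+-inverseʳ (h n)) (+-monoˡ-≤ (- h n) (h≤1 n))

  -- w solves the recurrence with y = 0, so scaling by w M measures how fast x M is forgotten.
  scaled-bound : ∀ {x y : ℕ → ℚ} {M δ} → 0ℚ ≤ δ → (∀ n → M ℕ.≤ n → y n ≤ δ) →
                 (∀ n → M ℕ.≤ n → x (suc n) ≡ (1ℚ - h n) * x n + h n * y n) →
                 ∀ t → w M * x (t ℕ.+ M) ≤ w M * δ + w (t ℕ.+ M) * x M
  scaled-bound {x} {y} {M} {δ} 0≤δ y≤δ x-suc zero =
    subst (_≤ w M * δ + w M * x M) (+-identityˡ (w M * x M))
          (+-monoˡ-≤ (w M * x M) (0≤p*q (0≤w M) 0≤δ))
  scaled-bound {x} {y} {M} {δ} 0≤δ y≤δ x-suc (suc t) = begin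
    w M * x (suc n)                                          ≡⟨ cong (w M *_) (x-suc n M≤n) ⟩
    w M * ((1ℚ - h n) * x n + h n * y n)                     ≡⟨ distribute (w M) (h n) (x n) (y n) ⟩
    (1ℚ - h n) * (w M * x n) + h n * (w M * y n)
      ≤⟨ +-mono-≤ (r*-mono-≤ (0≤1-h n) (scaled-bound 0≤δ y≤δ x-suc t))
                  (r*-mono-≤ (0≤h n) (r*-mono-≤ (0≤w M) (y≤δ n M≤n))) ⟩
    (1ℚ - h n) * (w M * δ + w n * x M) + h n * (w M * δ)     ≡⟨ collect (w M * δ) (h n) (w n) (x M) ⟩
    w M * δ + (1ℚ - h n) * w n * x M                         ≡⟨ cong (λ z → w M * δ + z * x M) (w-suc n) ⟨
    w M * δ + w (suc n) * x M                                ∎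
    where
    open ≤-Reasoning
    n = t ℕ.+ M
    M≤n : M ℕ.≤ n
    M≤n = ℕ.m≤n+m M t
    distribute : ∀ v h x y → v * ((1ℚ - h) * x + h * y) ≡ (1ℚ - h) * (v * x) + h * (v * y)
    distribute = solve 4 (λ v h x y → v :* ((con 1ℚ :- h) :* x :+ h :* y) := (con 1ℚ :- h) :* (v :* x) :+ h :* (v :* y)) refl
    collect : ∀ d h v c → (1ℚ - h) * (d + v * c) + h * d ≡ d + (1ℚ - h) * v * c
    collect = solve 4 (λ d h v c → (con 1ℚ :- h) :* (d :+ v :* c) :+ h :* d := d :+ (con 1ℚ :- h) :* v :* c) refl

  x<δ+δ : ∀ {x y : ℕ → ℚ} {M δ} → 0ℚ ≤ δ → (∀ n → M ℕ.≤ n → y n ≤ δ) →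
          (∀ n → M ℕ.≤ n → x (suc n) ≡ (1ℚ - h n) * x n + h n * y n) →
          ∀ {N} → M ℕ.≤ N → w N * x M < w M * δ → x N < δ + δ
  x<δ+δ {x} {y} {M} {δ} 0≤δ y≤δ x-suc {N} M≤N w[N]*x[M]<w[M]*δ =
    *-cancelˡ-<-nonNeg (w M) {{nonNegative (0≤w M)}} (begin-strict
      w M * x N                          ≡⟨ cong (λ k → w M * x k) (sym N∸M+M≡N) ⟩
      w M * x (N ℕ.∸ M ℕ.+ M)            ≤⟨ scaled-bound 0≤δ y≤δ x-suc (N ℕ.∸ M) ⟩
      w M * δ + w (N ℕ.∸ M ℕ.+ M) * x M  ≡⟨ cong (λ k → w M * δ + w k * x M) N∸M+M≡N ⟩
      w M * δ + w N * x M                <⟨ +-monoʳ-< (w M * δ) w[N]*x[M]<w[M]*δ ⟩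
      w M * δ + w M * δ                  ≡⟨ *-distribˡ-+ (w M) δ δ ⟨
      w M * (δ + δ)                      ∎)
    where
    open ≤-Reasoning
    N∸M+M≡N : N ℕ.∸ M ℕ.+ M ≡ N
    N∸M+M≡N = ℕ.m∸n+n≡m M≤N

  negligible : ∀ {x y : ℕ → ℚ} M₀ → Negligible y →
               (∀ n → M₀ ℕ.≤ n → x (suc n) ≡ (1ℚ - h n) * x n + h n * y n) → Negligible x
  negligible {x} {y} M₀ y≈0 x-suc ε 0<ε =
    let M₁ , y<ε/2 = y≈0 (ε * ½) (0<ε*½ 0<ε)
        M = M₁ ⊔ M₀
        M₂ , w*x[M]<w[M]*ε/2 = Negligible-*ʳ 0≤w w≈0 (x M) (w M * (ε * ½)) (0<p*q (0<w M) (0<ε*½ 0<ε))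
    in M ⊔ M₂ , λ N M⊔M₂≤N → subst (x N <_) (ε*½+ε*½≡ε ε)
         (x<δ+δ (<⇒≤ (0<ε*½ 0<ε))
                (λ n M≤n → <⇒≤ (y<ε/2 n (ℕ.≤-trans (ℕ.m≤m⊔n M₁ M₀) M≤n)))
                (λ n M≤n → x-suc n (ℕ.≤-trans (ℕ.m≤n⊔m M₁ M₀) M≤n))
                (ℕ.≤-trans (ℕ.m≤m⊔n M M₂) M⊔M₂≤N)
                (w*x[M]<w[M]*ε/2 N (ℕ.≤-trans (ℕ.m≤n⊔m M M₂) M⊔M₂≤N)))

damping : ℕ → ℚ
damping n = + 1 / (2 ℕ.* suc n)

damping-nonNeg : ∀ N → 0ℚ ≤ damping N
damping-nonNeg N = 0≤+m/d 1 (2 ℕ.* suc N)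

damping≤1 : ∀ N → damping N ≤ 1ℚ
damping≤1 N = +m/d≤+n/e 1 1 (2 ℕ.* suc N) 1 (s≤s z≤n)

a-suc*recip : ∀ n → a (suc n) * recip (suc n) ≡ damping n * a n
a-suc*recip n = begin
  a (suc n) * recip (suc n)                 ≡⟨ +m/d*+n/e c₁ 1 (4 ^ suc n) (suc (2 ℕ.* n)) ⟩
  + (c₁ ℕ.* 1) / (4 ^ suc n ℕ.* suc (2 ℕ.* n)) ≡⟨ +m/d≡+n/e (c₁ ℕ.* 1) (1 ℕ.* c) (4 ^ suc n ℕ.* suc (2 ℕ.* n)) q cross ⟩
  + (1 ℕ.* c) / q                           ≡⟨ +m/d*+n/e 1 c (2 ℕ.* suc n) p ⟨
  damping n * a n                           ∎
  where
  open ≡-Reasoning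
  c = central n
  c₁ = central (suc n)
  p = 4 ^ n
  q = 2 ℕ.* suc n ℕ.* p
  instance
    _ = ℕ.m^n≢0 4 n
    _ = ℕ.m^n≢0 4 (suc n)
    _ = ℕ.m*n≢0 (2 ℕ.* suc n) p
    _ = ℕ.m*n≢0 (4 ^ suc n) (suc (2 ℕ.* n))
  pull : ∀ n p c₁ → c₁ ℕ.* 1 ℕ.* (2 ℕ.* suc n ℕ.* p) ≡ 2 ℕ.* p ℕ.* (suc n ℕ.* c₁)
  pull = solve-∀
  push : ∀ n p c → 2 ℕ.* p ℕ.* (2 ℕ.* suc (2 ℕ.* n) ℕ.* c) ≡ 1 ℕ.* c ℕ.* (4 ℕ.* p ℕ.* suc (2 ℕ.* n))
  push = solve-∀
  cross : c₁ ℕ.* 1 ℕ.* q ≡ 1 ℕ.* c ℕ.* (4 ^ suc n ℕ.* suc (2 ℕ.* n))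
  cross = trans (pull n p c₁) (trans (cong (2 ℕ.* p ℕ.*_) (central-suc n)) (push n p c))

a-suc+damping*a≡a : ∀ n → a (suc n) + damping n * a n ≡ a n
a-suc+damping*a≡a n = begin
  a (suc n) + damping n * a n               ≡⟨ cong (λ x → a (suc n) + x) (+m/d*+n/e 1 c (2 ℕ.* suc n) p) ⟩
  a (suc n) + + (1 ℕ.* c) / q               ≡⟨ +m/d++n/e c₁ (1 ℕ.* c) (4 ^ suc n) q ⟩
  + numerator / (4 ^ suc n ℕ.* q)           ≡⟨ +m/d≡+n/e numerator c (4 ^ suc n ℕ.* q) p cross ⟩
  a n                                       ∎
  where
  open ≡-Reasoning
  c = central n
  c₁ = central (suc n)
  p = 4 ^ n
  q = 2 ℕ.* suc n ℕ.* p
  numerator = c₁ ℕ.* q ℕ.+ 1 ℕ.* c ℕ.* 4 ^ suc n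
  instance
    _ = ℕ.m^n≢0 4 n
    _ = ℕ.m^n≢0 4 (suc n)
    _ = ℕ.m*n≢0 (2 ℕ.* suc n) p
    _ = ℕ.m*n≢0 (4 ^ suc n) q
  pull : ∀ n p c c₁ → (c₁ ℕ.* (2 ℕ.* suc n ℕ.* p) ℕ.+ 1 ℕ.* c ℕ.* (4 ℕ.* p)) ℕ.* p
                      ≡ (2 ℕ.* p ℕ.* (suc n ℕ.* c₁) ℕ.+ 4 ℕ.* p ℕ.* c) ℕ.* p
  pull = solve-∀
  push : ∀ n p c → (2 ℕ.* p ℕ.* (2 ℕ.* suc (2 ℕ.* n) ℕ.* c) ℕ.+ 4 ℕ.* p ℕ.* c) ℕ.* p
                   ≡ c ℕ.* (4 ℕ.* p ℕ.* (2 ℕ.* suc n ℕ.* p))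
  push = solve-∀
  cross : numerator ℕ.* p ≡ c ℕ.* (4 ^ suc n ℕ.* q)
  cross = trans (pull n p c c₁)
                (trans (cong (λ x → (2 ℕ.* p ℕ.* x ℕ.+ 4 ℕ.* p ℕ.* c) ℕ.* p) (central-suc n)) (push n p c))

a-suc : ∀ n → a (suc n) ≡ (1ℚ - damping n) * a n
a-suc n = begin
  a (suc n)                                       ≡⟨ shift (a (suc n)) (damping n) (a n) ⟩
  (a (suc n) + damping n * a n) - damping n * a n ≡⟨ cong (_- damping n * a n) (a-suc+damping*a≡a n) ⟩
  a n - damping n * a n                           ≡⟨ factor (damping n) (a n) ⟩
  (1ℚ - damping n) * a n                          ∎
  where
  open ≡-Reasoning
  shift : ∀ x h y → x ≡ (x + h * y) - h * y
  shift = solve 3 (λ x h y → x := (x :+ h :* y) :- h :* y) refl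
  factor : ∀ h x → x - h * x ≡ (1ℚ - h) * x
  factor = solve 2 (λ h x → x :- h :* x := (con 1ℚ :- h) :* x) refl

a-pos : ∀ n → 0ℚ < a n
a-pos n = positive⁻¹ (a n) {{normalize-pos (central n) (4 ^ n) {{ℕ.m^n≢0 4 n}} {{ℕ.>-nonZero (central-pos n)}}}}

a-nonNeg : ∀ n → 0ℚ ≤ a n
a-nonNeg n = <⇒≤ (a-pos n)

a≤1/[1+K] : ∀ {K n} → suc K ℕ.* suc K ℕ.≤ n → a n ≤ + 1 / suc K
a≤1/[1+K] {K} {n} [1+K]²≤n = +m/d≤+n/e (central n) 1 (4 ^ n) (suc K) {{ℕ.m^n≢0 4 n}}
  (ℕ.≤-trans (K*K≤n⇒central*K≤4^n [1+K]²≤n) (ℕ.≤-reflexive (sym (ℕ.*-identityˡ (4 ^ n)))))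

a-negligible : Negligible a
a-negligible ε 0<ε =
  let K , 1/[1+K]<ε = archimedean ε 0<ε
  in suc K ℕ.* suc K , λ N [1+K]²≤N → ≤-<-trans (a≤1/[1+K] {K} [1+K]²≤N) 1/[1+K]<ε

sumFrom-suc : ∀ {lo hi} f → lo ℕ.≤ hi → sumFrom lo (suc hi) f ≡ sumFrom lo hi f + f hi
sumFrom-suc {lo} {hi} f lo≤hi with lo ℕ.≤ᵇ hi | ℕ.≤⇒≤ᵇ lo≤hi
... | true | _ = refl

sumFrom-empty : ∀ {lo hi} f → hi ℕ.≤ lo → sumFrom lo hi f ≡ 0ℚ
sumFrom-empty {lo} {zero} f _ = refl
sumFrom-empty {lo} {suc hi} f hi<lo with lo ℕ.≤ᵇ hi in lo≤ᵇhi
... | false = trans (+-identityʳ _) (sumFrom-empty f (ℕ.<⇒≤ hi<lo))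
... | true = ⊥-elim (ℕ.<⇒≱ hi<lo (ℕ.≤ᵇ⇒≤ lo hi (subst T (sym lo≤ᵇhi) _)))

sumFrom-nonNeg : ∀ lo hi {f} → (∀ m → 0ℚ ≤ f m) → 0ℚ ≤ sumFrom lo hi f
sumFrom-nonNeg lo zero 0≤f = ≤-refl
sumFrom-nonNeg lo (suc hi) {f} 0≤f = +-mono-≤ (sumFrom-nonNeg lo hi 0≤f) (0≤last (lo ℕ.≤ᵇ hi))
  where
  0≤last : ∀ b → 0ℚ ≤ (if b then f hi else 0ℚ)
  0≤last true = 0≤f hi
  0≤last false = ≤-refl

recip-nonNeg : ∀ m → 0ℚ ≤ recip m
recip-nonNeg zero = ≤-refl
recip-nonNeg (suc k) = 0≤+m/d 1 (suc (2 ℕ.* k))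

tailSum-nonNeg : ∀ n k u → 0ℚ ≤ tailSum n k u
tailSum-nonNeg n zero u = 0≤+m/d 1 1
tailSum-nonNeg n (suc k) u = sumFrom-nonNeg (suc n) u (λ m → 0≤p*q (recip-nonNeg m) (tailSum-nonNeg n k m))

tailSum-empty : ∀ n k → tailSum n (suc k) (suc n) ≡ 0ℚ
tailSum-empty n k = sumFrom-empty {suc n} {suc n} _ ℕ.≤-refl

tailSum-suc : ∀ {n N} k → n ℕ.≤ N →
              tailSum n (suc k) (suc (suc N)) ≡ tailSum n (suc k) (suc N) + recip (suc N) * tailSum n k (suc N)
tailSum-suc k n≤N = sumFrom-suc _ (s≤s n≤N)

weightedTail : ℕ → ℕ → ℕ → ℚ
weightedTail n k N = a N * tailSum n k (suc N)

remainder : ℕ → ℕ → ℕ → ℚ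
remainder n zero N = weightedTail n zero N
remainder n (suc k) N = remainder n k N + weightedTail n (suc k) N

weightedTail-nonNeg : ∀ n k N → 0ℚ ≤ weightedTail n k N
weightedTail-nonNeg n k N = 0≤p*q (a-nonNeg N) (tailSum-nonNeg n k (suc N))

remainder-nonNeg : ∀ n k N → 0ℚ ≤ remainder n k N
remainder-nonNeg n zero N = weightedTail-nonNeg n zero N
remainder-nonNeg n (suc k) N = +-mono-≤ (remainder-nonNeg n k N) (weightedTail-nonNeg n (suc k) N)

weightedTail-zero-suc : ∀ n N → weightedTail n zero (suc N) ≡ (1ℚ - damping N) * weightedTail n zero N
weightedTail-zero-suc n N = trans (cong (_* 1ℚ) (a-suc N)) (*-assoc (1ℚ - damping N) (a N) 1ℚ)

weightedTail-suc : ∀ {n N} k → n ℕ.≤ N →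
  weightedTail n (suc k) (suc N) ≡ (1ℚ - damping N) * weightedTail n (suc k) N + damping N * weightedTail n k N
weightedTail-suc {n} {N} k n≤N = begin
  a (suc N) * tailSum n (suc k) (suc (suc N))       ≡⟨ cong (a (suc N) *_) (tailSum-suc k n≤N) ⟩
  a (suc N) * (S + recip (suc N) * S′)              ≡⟨ distribute (a (suc N)) S (recip (suc N)) S′ ⟩
  a (suc N) * S + a (suc N) * recip (suc N) * S′    ≡⟨ cong₂ (λ u v → u * S + v * S′) (a-suc N) (a-suc*recip N) ⟩
  (1ℚ - damping N) * a N * S + damping N * a N * S′ ≡⟨ cong₂ _+_ (*-assoc (1ℚ - damping N) (a N) S) (*-assoc (damping N) (a N) S′) ⟩
  (1ℚ - damping N) * (a N * S) + damping N * (a N * S′) ∎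
  where
  open ≡-Reasoning
  S = tailSum n (suc k) (suc N)
  S′ = tailSum n k (suc N)
  distribute : ∀ x p r q → x * (p + r * q) ≡ x * p + x * r * q
  distribute = solve 4 (λ x p r q → x :* (p :+ r :* q) := x :* p :+ x :* r :* q) refl

remainder-suc : ∀ {n N} k → n ℕ.≤ N → remainder n k (suc N) ≡ remainder n k N - damping N * weightedTail n k N
remainder-suc {n} {N} zero n≤N = trans (weightedTail-zero-suc n N) (expand (damping N) (weightedTail n zero N))
  where
  expand : ∀ h b → (1ℚ - h) * b ≡ b - h * b
  expand = solve 2 (λ h b → (con 1ℚ :- h) :* b := b :- h :* b) refl
remainder-suc {n} {N} (suc k) n≤N =
  trans (cong₂ _+_ (remainder-suc k n≤N) (weightedTail-suc k n≤N))
        (telescope (remainder n k N) (damping N) (weightedTail n k N) (weightedTail n (suc k) N))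
  where
  telescope : ∀ r h b b′ → (r - h * b) + ((1ℚ - h) * b′ + h * b) ≡ (r + b′) - h * b′
  telescope = solve 4 (λ r h b b′ → (r :- h :* b) :+ ((con 1ℚ :- h) :* b′ :+ h :* b) := (r :+ b′) :- h :* b′) refl

remainder-start : ∀ n k → remainder n k n ≡ a n
remainder-start n zero = *-identityʳ (a n)
remainder-start n (suc k) = begin
  remainder n k n + a n * tailSum n (suc k) (suc n) ≡⟨ cong₂ (λ r t → r + a n * t) (remainder-start n k) (tailSum-empty n k) ⟩
  a n + a n * 0ℚ                                   ≡⟨ cong (λ x → a n + x) (*-zeroʳ (a n)) ⟩
  a n + 0ℚ                                         ≡⟨ +-identityʳ (a n) ⟩
  a n                                              ∎
  where open ≡-Reasoning

partialSum-suc : ∀ {n N} k → n ℕ.≤ N → partialSum n (suc k) (suc N) ≡ partialSum n (suc k) N + damping N * weightedTail n k N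
partialSum-suc {n} {N} k n≤N = begin
  partialSum n (suc k) (suc N)                                         ≡⟨ sumFrom-suc _ (s≤s n≤N) ⟩
  partialSum n (suc k) N + a (suc N) * recip (suc N) * tailSum n k (suc N) ≡⟨ cong (λ u → partialSum n (suc k) N + u * tailSum n k (suc N)) (a-suc*recip N) ⟩
  partialSum n (suc k) N + damping N * a N * tailSum n k (suc N)       ≡⟨ cong (λ u → partialSum n (suc k) N + u) (*-assoc (damping N) (a N) _) ⟩
  partialSum n (suc k) N + damping N * weightedTail n k N              ∎
  where open ≡-Reasoning

partialSum+remainder≡a : ∀ {n N} k → n ℕ.≤′ N → partialSum n (suc k) N + remainder n k N ≡ a n
partialSum+remainder≡a {n} k ℕ.≤′-refl =
  trans (cong₂ _+_ (sumFrom-empty {suc n} {suc n} _ ℕ.≤-refl) (remainder-start n k)) (+-identityˡ (a n))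
partialSum+remainder≡a {n} {suc N} k (ℕ.≤′-step n≤′N) = begin
  partialSum n (suc k) (suc N) + remainder n k (suc N)
    ≡⟨ cong₂ _+_ (partialSum-suc k n≤N) (remainder-suc k n≤N) ⟩
  (partialSum n (suc k) N + damping N * weightedTail n k N) + (remainder n k N - damping N * weightedTail n k N)
    ≡⟨ cancel (partialSum n (suc k) N) (damping N * weightedTail n k N) (remainder n k N) ⟩
  partialSum n (suc k) N + remainder n k N
    ≡⟨ partialSum+remainder≡a k n≤′N ⟩
  a n ∎
  where
  open ≡-Reasoning
  n≤N = ℕ.≤′⇒≤ n≤′N
  cancel : ∀ p d r → (p + d) + (r - d) ≡ p + r
  cancel = solve 3 (λ p d r → (p :+ d) :+ (r :- d) := p :+ r) refl

∣partialSum-a∣≡remainder : ∀ {n N} k → n ℕ.≤ N → ∣ partialSum n (suc k) N - a n ∣ ≡ remainder n k N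
∣partialSum-a∣≡remainder {n} {N} k n≤N = begin
  ∣ P - a n ∣        ≡⟨ cong (λ x → ∣ P - x ∣) (sym (partialSum+remainder≡a k (ℕ.≤⇒≤′ n≤N))) ⟩
  ∣ P - (P + R) ∣    ≡⟨ cong ∣_∣ (difference P R) ⟩
  ∣ - R ∣            ≡⟨ ∣-p∣≡∣p∣ R ⟩
  ∣ R ∣              ≡⟨ 0≤p⇒∣p∣≡p (remainder-nonNeg n k N) ⟩
  R                  ∎
  where
  open ≡-Reasoning
  P = partialSum n (suc k) N
  R = remainder n k N
  difference : ∀ p r → p - (p + r) ≡ - r
  difference = solve 2 (λ p r → p :- (p :+ r) := :- r) refl

weightedTail-negligible : ∀ n k → Negligible (weightedTail n k)
weightedTail-negligible n zero = Negligible-*ʳ a-nonNeg a-negligible 1ℚ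
weightedTail-negligible n (suc k) = negligible n (weightedTail-negligible n k) (λ N n≤N → weightedTail-suc k n≤N)
  where open DampedRecurrence damping a damping-nonNeg damping≤1 a-pos a-suc a-negligible

remainder-negligible : ∀ n k → Negligible (remainder n k)
remainder-negligible n zero = weightedTail-negligible n zero
remainder-negligible n (suc k) = Negligible-+ (remainder-negligible n k) (weightedTail-negligible n (suc k))

mainTheorem4 : (n d : ℕ) → 1 ℕ.≤ d → (ε : ℚ) → 0ℚ < ε →
    Σ ℕ (λ N₀ → (N : ℕ) → N₀ ℕ.≤ N → ∣ partialSum n d N - a n ∣ < ε)
mainTheorem4 n (suc k) _ ε 0<ε =
  let M , remainder<ε = remainder-negligible n k ε 0<ε
  in M ⊔ n , λ N M⊔n≤N →
       subst (_< ε) (sym (∣partialSum-a∣≡remainder k (ℕ.≤-trans (ℕ.m≤n⊔m M n) M⊔n≤N)))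
             (remainder<ε N (ℕ.≤-trans (ℕ.m≤m⊔n M n) M⊔n≤N))
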